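{- Let $k$ be a positive integer and $G\in\Delta_k$. <ol> <li>If $G$ is Type-A, then $G$ has at least $2^k$ orbits.</li> <li>If $G$ is Type-B, then $G$ has at least $2\cdot 2^k$ orbits.</li> <li>If $G$ is Type-C, then $G$ has at least $3\cdot2^k$ orbits.</li> </ol>
   Context: Graphs are finite and simple. A delta composition of $G_1,G_2,G_3$ is obtained from their disjoint union by choosing $v_i\in V(G_i)$ and adding the triangle $v_1v_2v_3$. $\Delta_0=\{K_2\}$, and for $i\ge1$, $\Delta_i$ is the set of delta compositions of three (not necessarily distinct) graphs in $\Delta_{i-1}$, up to isomorphism. For $k\ge1$, every $G\in\Delta_k$ has a unique triangle $v_1v_2v_3$ whose edge removal leaves exactly three components $G_1\ni v_1$, $G_2\ni v_2$, $G_3\ni v_3$, each in $\Delta_{k-1}$, so that $G$ is their delta composition. Rooted graphs $(G_i,v_i)$ and $(G_j,v_j)$ are isomorphic if some isomorphism $G_i\to G_j$ maps $v_i$ to $v_j$. $G$ is called: <ul> <li>Type-A if $(G_1,v_1),(G_2,v_2),(G_3,v_3)$ are pairwise isomorphic;</li> <li>Type-B if exactly two of them are isomorphic;</li> <li>Type-C otherwise.</li> </ul> The orbit of $x\in V(G)$ in $G$ is $\{f(x): f\in\mathrm{Aut}(G)\}$, and the number of orbits of $G$ is the number of distinct such sets. -}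

module Defs where

open import Data.Nat using (ℕ; zero; suc; _+_)
open import Data.Fin using (Fin; zero; suc; splitAt; _≟_)
open import Data.Fin.Permutation using (Permutation; Permutation′; _⟨$⟩ʳ_)
open import Data.Bool using (Bool; true; false; _∧_)
open import Data.Bool.Properties using (∧-comm)
open import Data.Sum using (_⊎_; inj₁; inj₂)
open import Data.Product using (Σ; _×_; _,_; proj₁)
open import Relation.Nullary using (¬_)
open import Relation.Nullary.Decidable using (⌊_⌋)
open import Relation.Binary.PropositionalEquality using (_≡_; refl)

record Graph : Set where
  field
    n      : ℕ
    adj    : Fin n → Fin n → Bool
    sym    : ∀ x y → adj x y ≡ adj y x
    irrefl : ∀ x → adj x x ≡ false
open Graph public

K₂ : Graph
K₂ = record { n = 2 ; adj = a ; sym = s ; irrefl = i }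
  where
  a : Fin 2 → Fin 2 → Bool
  a zero zero = false
  a zero (suc zero) = true
  a (suc zero) zero = true
  a (suc zero) (suc zero) = false
  s : ∀ x y → a x y ≡ a y x
  s zero zero = refl
  s zero (suc zero) = refl
  s (suc zero) zero = refl
  s (suc zero) (suc zero) = refl
  i : ∀ x → a x x ≡ false
  i zero = refl
  i (suc zero) = refl

_≅_ : Graph → Graph → Set
G ≅ H = Σ (Permutation (n G) (n H)) λ π →
          ∀ x y → adj H (π ⟨$⟩ʳ x) (π ⟨$⟩ʳ y) ≡ adj G x y

RootedIso : (G : Graph) → Fin (n G) → (H : Graph) → Fin (n H) → Set
RootedIso G u H v = Σ (Permutation (n G) (n H)) λ π →
  (∀ x y → adj H (π ⟨$⟩ʳ x) (π ⟨$⟩ʳ y) ≡ adj G x y) × (π ⟨$⟩ʳ u ≡ v)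

-- Delta composition of G₁, G₂, G₃ at v₁, v₂, v₃:
-- disjoint union on Fin (n₁ + (n₂ + n₃)) plus the triangle v₁v₂v₃.

Part : ℕ → ℕ → ℕ → Set
Part n₁ n₂ n₃ = Fin n₁ ⊎ (Fin n₂ ⊎ Fin n₃)

part : ∀ n₁ n₂ n₃ → Fin (n₁ + (n₂ + n₃)) → Part n₁ n₂ n₃
part n₁ n₂ n₃ x with splitAt n₁ x
... | inj₁ a = inj₁ a
... | inj₂ b with splitAt n₂ b
... | inj₁ c = inj₂ (inj₁ c)
... | inj₂ d = inj₂ (inj₂ d)

module _ (G₁ G₂ G₃ : Graph) (v₁ : Fin (n G₁)) (v₂ : Fin (n G₂)) (v₃ : Fin (n G₃)) where

  private
    P = Part (n G₁) (n G₂) (n G₃)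

    is : ∀ {m} → Fin m → Fin m → Bool
    is a v = ⌊ a ≟ v ⌋

    padj : P → P → Bool
    padj (inj₁ a)        (inj₁ b)        = adj G₁ a b
    padj (inj₂ (inj₁ a)) (inj₂ (inj₁ b)) = adj G₂ a b
    padj (inj₂ (inj₂ a)) (inj₂ (inj₂ b)) = adj G₃ a b
    padj (inj₁ a)        (inj₂ (inj₁ b)) = is a v₁ ∧ is b v₂
    padj (inj₁ a)        (inj₂ (inj₂ b)) = is a v₁ ∧ is b v₃
    padj (inj₂ (inj₁ a)) (inj₁ b)        = is a v₂ ∧ is b v₁
    padj (inj₂ (inj₁ a)) (inj₂ (inj₂ b)) = is a v₂ ∧ is b v₃
    padj (inj₂ (inj₂ a)) (inj₁ b)        = is a v₃ ∧ is b v₁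
    padj (inj₂ (inj₂ a)) (inj₂ (inj₁ b)) = is a v₃ ∧ is b v₂

    psym : ∀ p q → padj p q ≡ padj q p
    psym (inj₁ a)        (inj₁ b)        = sym G₁ a b
    psym (inj₂ (inj₁ a)) (inj₂ (inj₁ b)) = sym G₂ a b
    psym (inj₂ (inj₂ a)) (inj₂ (inj₂ b)) = sym G₃ a b
    psym (inj₁ a)        (inj₂ (inj₁ b)) = ∧-comm (is a v₁) (is b v₂)
    psym (inj₁ a)        (inj₂ (inj₂ b)) = ∧-comm (is a v₁) (is b v₃)
    psym (inj₂ (inj₁ a)) (inj₁ b)        = ∧-comm (is a v₂) (is b v₁)
    psym (inj₂ (inj₁ a)) (inj₂ (inj₂ b)) = ∧-comm (is a v₂) (is b v₃)
    psym (inj₂ (inj₂ a)) (inj₁ b)        = ∧-comm (is a v₃) (is b v₁)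
    psym (inj₂ (inj₂ a)) (inj₂ (inj₁ b)) = ∧-comm (is a v₃) (is b v₂)

    pirr : ∀ p → padj p p ≡ false
    pirr (inj₁ a)        = irrefl G₁ a
    pirr (inj₂ (inj₁ a)) = irrefl G₂ a
    pirr (inj₂ (inj₂ a)) = irrefl G₃ a

    pt = part (n G₁) (n G₂) (n G₃)

  deltaComp : Graph
  deltaComp = record
    { n      = n G₁ + (n G₂ + n G₃)
    ; adj    = λ x y → padj (pt x) (pt y)
    ; sym    = λ x y → psym (pt x) (pt y)
    ; irrefl = λ x → pirr (pt x)
    }

data InΔ : ℕ → Graph → Set where
  base : ∀ {G} → G ≅ K₂ → InΔ 0 G
  step : ∀ {k G} (G₁ G₂ G₃ : Graph)
           (v₁ : Fin (n G₁)) (v₂ : Fin (n G₂)) (v₃ : Fin (n G₃)) →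
         InΔ k G₁ → InΔ k G₂ → InΔ k G₃ →
         G ≅ deltaComp G₁ G₂ G₃ v₁ v₂ v₃ → InΔ (suc k) G

module _ (G₁ G₂ G₃ : Graph) (v₁ : Fin (n G₁)) (v₂ : Fin (n G₂)) (v₃ : Fin (n G₃)) where

  R₁₂ R₁₃ R₂₃ : Set
  R₁₂ = RootedIso G₁ v₁ G₂ v₂
  R₁₃ = RootedIso G₁ v₁ G₃ v₃
  R₂₃ = RootedIso G₂ v₂ G₃ v₃

  TypeA : Set
  TypeA = R₁₂ × R₁₃ × R₂₃

  TypeB : Set
  TypeB = (R₁₂ × ¬ R₁₃ × ¬ R₂₃) ⊎ ((¬ R₁₂ × R₁₃ × ¬ R₂₃) ⊎ (¬ R₁₂ × ¬ R₁₃ × R₂₃))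

  TypeC : Set
  TypeC = ¬ TypeA × ¬ TypeB

Aut : Graph → Set
Aut G = Σ (Permutation′ (n G)) λ π →
          ∀ x y → adj G (π ⟨$⟩ʳ x) (π ⟨$⟩ʳ y) ≡ adj G x y

SameOrbit : (G : Graph) → Fin (n G) → Fin (n G) → Set
SameOrbit G x y = Σ (Aut G) λ f → proj₁ f ⟨$⟩ʳ x ≡ y

AtLeastOrbits : ℕ → Graph → Set
AtLeastOrbits m G = Σ (Fin m → Fin (n G)) λ r →
  ∀ i j → SameOrbit G (r i) (r j) → i ≡ j

-- Every graph in Δⱼ is connected and all of them have the same number of vertices.  In a
-- delta composition D of three such graphs every automorphism f maps the central triangle onto
-- itself: otherwise the image triangle lies inside one branch (edges between branches only join
-- the roots), and from one of its vertices one reaches, without using an edge of the image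
-- triangle, the corner of that branch and all of another branch.  Pulling back along f, a corner
-- of the triangle would reach more vertices than a branch has without using a triangle edge,
-- although such walks never leave its branch.  So automorphisms permute the branches, and
-- restrict to rooted isomorphisms between them.
--
-- By induction on j, for every vertex v of a graph in Δⱼ the automorphisms fixing v have at
-- least 2^(j+1) orbits.  If v lies in branch i they map branch i to itself, so on branch i
-- they have the 2^(j+1) orbits given by induction; two vertices of a second branch in one
-- orbit are related by an automorphism of that branch fixing its root, which gives 2^(j+1)
-- further orbits.  In the theorem each branch, with its root fixed, yields 2^k orbits of G,
-- and branches that are not isomorphic as rooted graphs yield disjoint ones.

module Submission where

open import Defs hiding (sym)
open import Data.Nat using (ℕ; zero; suc; _+_; _≤_; _∸_; _*_; _^_)
open import Data.Nat.Properties using (<-irrefl)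
open import Data.Fin using (Fin; zero; suc; splitAt; _≟_; _↑ˡ_; _↑ʳ_)
open import Data.Fin.Properties
  using (splitAt-↑ˡ; splitAt-↑ʳ; splitAt⁻¹-↑ˡ; splitAt⁻¹-↑ʳ; injective⇒≤)
open import Data.Fin.Permutation
  using (Permutation′; _⟨$⟩ʳ_; _⟨$⟩ˡ_; inverseˡ; inverseʳ; flip; _∘ₚ_; permutation; ↔⇒≡)
open import Data.Vec.Functional using (_++_; [])
open import Data.Bool using (true; _∧_)
open import Data.Sum using (_⊎_; inj₁; inj₂)
open import Data.Product using (Σ; _×_; _,_; proj₁; proj₂)
open import Data.Empty using (⊥; ⊥-elim)
open import Data.Unit using (⊤; tt)
open import Function using (_∘_; id; const)
open import Function.Definitions using (Injective)
open import Relation.Nullary using (¬_; Dec; yes; no)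
open import Relation.Nullary.Decidable using (⌊_⌋)
open import Relation.Binary.PropositionalEquality

data Reach (G : Graph) (S : Fin (n G) → Set) (x : Fin (n G)) : Fin (n G) → Set where
  here : Reach G S x x
  step : ∀ {y z} → Reach G S x y → adj G y z ≡ true → ¬ (S y × S z) → Reach G S x z

module _ {G : Graph} {S : Fin (n G) → Set} where

  Reach-trans : ∀ {x y z} → Reach G S x y → Reach G S y z → Reach G S x z
  Reach-trans p here           = p
  Reach-trans p (step q yz ¬S) = step (Reach-trans p q) yz ¬S

  Reach-sym : ∀ {x y} → Reach G S x y → Reach G S y x
  Reach-sym here = here
  Reach-sym {y = z} (step {y} p yz ¬S) =
    Reach-trans (step here (trans (Graph.sym G z y) yz) λ (sz , sy) → ¬S (sy , sz)) (Reach-sym p)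

Reach-map : ∀ {G H S S′} (g : Fin (n G) → Fin (n H)) →
  (∀ a b → adj H (g a) (g b) ≡ adj G a b) →
  (∀ a b → adj G a b ≡ true → ¬ (S a × S b) → ¬ (S′ (g a) × S′ (g b))) →
  ∀ {x y} → Reach G S x y → Reach H S′ (g x) (g y)
Reach-map g g-adj g-S here = here
Reach-map g g-adj g-S (step {y} {z} p yz ¬S) =
  step (Reach-map g g-adj g-S p) (trans (g-adj y z) yz) (g-S y z yz ¬S)

Connected : Graph → Set
Connected G = ∀ x y → Reach G (const ⊥) x y

Reach-until : ∀ {G S} → (∀ x → Dec (S x)) → ∀ {x y} → Reach G (const ⊥) x y →
  (Σ (Fin (n G)) λ w → S w × Reach G S x w) ⊎ Reach G S x y
Reach-until S? here = inj₂ here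
Reach-until S? (step {y} p yz _) with Reach-until S? p
... | inj₁ hit = inj₁ hit
... | inj₂ q with S? y
...   | yes Sy = inj₁ (y , Sy , q)
...   | no ¬Sy = inj₂ (step q yz (¬Sy ∘ proj₁))

first-hit : ∀ {G S} → (∀ x → Dec (S x)) → ∀ {x y} → Reach G (const ⊥) x y → S y →
  Σ (Fin (n G)) λ w → S w × Reach G S x w
first-hit S? p Sy with Reach-until S? p
... | inj₁ hit = hit
... | inj₂ q   = _ , Sy , q

infixr 5 _·_

-- Stated for any family over permutations so that a graph never has to be inferred from Aut G.
_·_ : ∀ {m} {P : Permutation′ m → Set} → Σ (Permutation′ m) P → Fin m → Fin m
f · x = proj₁ f ⟨$⟩ʳ x

module Transport {G H : Graph} (iso : G ≅ H) where

  private
    π = proj₁ iso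

  adj⁻¹ : ∀ a b → adj G (π ⟨$⟩ˡ a) (π ⟨$⟩ˡ b) ≡ adj H a b
  adj⁻¹ a b = subst₂ (λ x y → adj G (π ⟨$⟩ˡ a) (π ⟨$⟩ˡ b) ≡ adj H x y) (inverseʳ π) (inverseʳ π)
                (sym (proj₂ iso (π ⟨$⟩ˡ a) (π ⟨$⟩ˡ b)))

  transport : Aut G → Aut H
  transport (g , g-adj) = flip π ∘ₚ g ∘ₚ π , λ x y →
    trans (proj₂ iso _ _) (trans (g-adj _ _) (adj⁻¹ x y))

RootedIso-sym : ∀ {G u H v} → RootedIso G u H v → RootedIso H v G u
RootedIso-sym {G} {H = H} (π , π-adj , πu) =
  flip π , Transport.adj⁻¹ {G} {H} (π , π-adj) , trans (cong (π ⟨$⟩ˡ_) (sym πu)) (inverseˡ π)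

RootedIso-trans : ∀ {G u H v K w} → RootedIso G u H v → RootedIso H v K w → RootedIso G u K w
RootedIso-trans (π , π-adj , πu) (ρ , ρ-adj , ρv) =
  π ∘ₚ ρ , (λ x y → trans (ρ-adj _ _) (π-adj x y)) , trans (cong (ρ ⟨$⟩ʳ_) πu) ρv

module Automorphisms (G : Graph) where

  inverse : Aut G → Aut G
  inverse f = flip (proj₁ f) , Transport.adj⁻¹ {G} {G} f

  module _ (f : Aut G) where

    ·-inverseˡ : ∀ {x} → inverse f · f · x ≡ x
    ·-inverseˡ = inverseˡ (proj₁ f)

    ·-inverseʳ : ∀ {x} → f · inverse f · x ≡ x
    ·-inverseʳ = inverseʳ (proj₁ f)

    ·-injective : Injective _≡_ _≡_ (f ·_)
    ·-injective e = trans (sym ·-inverseˡ) (trans (cong (inverse f ·_) e) ·-inverseˡ)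

  Fixes : Fin (n G) → Aut G → Set
  Fixes w f = f · w ≡ w

  Fixes-inverse : ∀ {w} f → Fixes w f → Fixes w (inverse f)
  Fixes-inverse f fw = trans (cong (inverse f ·_) (sym fw)) (·-inverseˡ f)

  module _ (P : Aut G → Set) where

    Separated : ∀ {m} → (Fin m → Fin (n G)) → Set
    Separated r = ∀ p q (f : Aut G) → P f → f · r p ≡ r q → p ≡ q

    Apart : ∀ {a b} → (Fin a → Fin (n G)) → (Fin b → Fin (n G)) → Set
    Apart r s = ∀ p q (f : Aut G) → P f → f · r p ≢ s q

  module _ {P : Aut G → Set} where

    Separated-[] : Separated P []
    Separated-[] ()

    Separated-++ : ∀ {a b} {r : Fin a → Fin (n G)} {s : Fin b → Fin (n G)} →
      Separated P r → Separated P s → Apart P r s → Apart P s r → Separated P (r ++ s)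
    Separated-++ {a} {b} sep-r sep-s r∦s s∦r p q f Pf e
      with splitAt a {b} p in p≡ | splitAt a {b} q in q≡
    ... | inj₁ p′ | inj₁ q′ = trans (sym (splitAt⁻¹-↑ˡ p≡))
                                (trans (cong (_↑ˡ b) (sep-r p′ q′ f Pf e)) (splitAt⁻¹-↑ˡ q≡))
    ... | inj₂ p′ | inj₂ q′ = trans (sym (splitAt⁻¹-↑ʳ p≡))
                                (trans (cong (a ↑ʳ_) (sep-s p′ q′ f Pf e)) (splitAt⁻¹-↑ʳ q≡))
    ... | inj₁ p′ | inj₂ q′ = ⊥-elim (r∦s p′ q′ f Pf e)
    ... | inj₂ p′ | inj₁ q′ = ⊥-elim (s∦r p′ q′ f Pf e)

    Apart-[]ˡ : ∀ {a} {r : Fin a → Fin (n G)} → Apart P [] r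
    Apart-[]ˡ ()

    Apart-[]ʳ : ∀ {a} {r : Fin a → Fin (n G)} → Apart P r []
    Apart-[]ʳ p ()

    Apart-++ˡ : ∀ {a b c} {r : Fin a → Fin (n G)} {s : Fin b → Fin (n G)} {t : Fin c → Fin (n G)} →
      Apart P s r → Apart P t r → Apart P (s ++ t) r
    Apart-++ˡ {b = b} s∦r t∦r p q f Pf with splitAt b p
    ... | inj₁ p′ = s∦r p′ q f Pf
    ... | inj₂ p′ = t∦r p′ q f Pf

    Apart-++ʳ : ∀ {a b c} {r : Fin a → Fin (n G)} {s : Fin b → Fin (n G)} {t : Fin c → Fin (n G)} →
      Apart P r s → Apart P r t → Apart P r (s ++ t)
    Apart-++ʳ {b = b} r∦s r∦t p q f Pf with splitAt b q
    ... | inj₁ q′ = r∦s p q′ f Pf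
    ... | inj₂ q′ = r∦t p q′ f Pf

    Apart-sym : (∀ f → P f → P (inverse f)) →
      ∀ {a b} {r : Fin a → Fin (n G)} {s : Fin b → Fin (n G)} → Apart P r s → Apart P s r
    Apart-sym P-inverse r∦s p q f Pf e =
      r∦s q p (inverse f) (P-inverse f Pf) (trans (cong (inverse f ·_) (sym e)) (·-inverseˡ f))

    -- r ++ (s ++ []) has length m + (m + 0), which is 2 * m by computation; likewise for 3 * m.
    Separated-pair : ∀ {m} {r s : Fin m → Fin (n G)} →
      Separated P r → Separated P s → Apart P r s → Apart P s r → Separated P (r ++ (s ++ []))
    Separated-pair sep-r sep-s r∦s s∦r =
      Separated-++ sep-r (Separated-++ sep-s Separated-[] Apart-[]ʳ Apart-[]ˡ)
        (Apart-++ʳ r∦s Apart-[]ʳ) (Apart-++ˡ s∦r Apart-[]ˡ)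

    Separated-triple : ∀ {m} {r s t : Fin m → Fin (n G)} →
      Separated P r → Separated P s → Separated P t →
      Apart P r s → Apart P s r → Apart P r t → Apart P t r → Apart P s t → Apart P t s →
      Separated P (r ++ (s ++ (t ++ [])))
    Separated-triple sep-r sep-s sep-t r∦s s∦r r∦t t∦r s∦t t∦s =
      Separated-++ sep-r (Separated-pair sep-s sep-t s∦t t∦s)
        (Apart-++ʳ r∦s (Apart-++ʳ r∦t Apart-[]ʳ)) (Apart-++ˡ s∦r (Apart-++ˡ t∦r Apart-[]ˡ))

AtLeastOrbitsFixing : ℕ → (G : Graph) → Fin (n G) → Set
AtLeastOrbitsFixing m G v = Σ (Fin m → Fin (n G)) (Separated (Fixes v))
  where open Automorphisms G

two-orbits-fixing : ∀ G {u v : Fin (n G)} → u ≢ v → AtLeastOrbitsFixing 2 G v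
two-orbits-fixing G {u} {v} u≢v = r , separated
  where
  open Automorphisms G
  r : Fin 2 → Fin (n G)
  r zero       = v
  r (suc zero) = u
  separated : Separated (Fixes v) r
  separated zero       zero       f fv e = refl
  separated (suc zero) (suc zero) f fv e = refl
  separated zero       (suc zero) f fv e = ⊥-elim (u≢v (trans (sym e) fv))
  separated (suc zero) zero       f fv e = ⊥-elim (u≢v (·-injective f (trans e (sym fv))))

module _ {G H : Graph} (iso : G ≅ H) where

  open Transport {G} {H} iso
  private
    module AG = Automorphisms G
    module AH = Automorphisms H
    π = proj₁ iso

  Separated-≅ : ∀ {P Q} → (∀ g → Q g → P (transport g)) →
    ∀ {m} {r : Fin m → Fin (n H)} → AH.Separated P r → AG.Separated Q ((π ⟨$⟩ˡ_) ∘ r)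
  Separated-≅ QP sep p q g Qg e = sep p q _ (QP g Qg) (trans (cong (π ⟨$⟩ʳ_) e) (inverseʳ π))

  AtLeastOrbitsFixing-≅ : ∀ {m v} → AtLeastOrbitsFixing m H (π ⟨$⟩ʳ v) → AtLeastOrbitsFixing m G v
  AtLeastOrbitsFixing-≅ (r , sep) =
    (π ⟨$⟩ˡ_) ∘ r , Separated-≅ (λ g gv → cong (π ⟨$⟩ʳ_) (trans (cong (g ·_) (inverseˡ π)) gv)) sep

  AtLeastOrbits-≅ : ∀ {m} {r : Fin m → Fin (n H)} → AH.Separated (const ⊤) r → AtLeastOrbits m G
  AtLeastOrbits-≅ sep = _ , λ p q (g , e) → Separated-≅ (λ _ _ → tt) sep p q g tt e

other-vertex-≅K₂ : ∀ {H} → H ≅ K₂ → (v : Fin (n H)) → Σ (Fin (n H)) λ u → u ≢ v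
other-vertex-≅K₂ (π , _) v = π ⟨$⟩ˡ opposite (π ⟨$⟩ʳ v) ,
  λ e → opposite-≢ (π ⟨$⟩ʳ v) (trans (sym (inverseʳ π)) (cong (π ⟨$⟩ʳ_) e))
  where
  opposite : Fin 2 → Fin 2
  opposite zero       = suc zero
  opposite (suc zero) = zero
  opposite-≢ : ∀ x → opposite x ≢ x
  opposite-≢ zero       ()
  opposite-≢ (suc zero) ()

≟∧≟≡true⇒≡ : ∀ {k l} (a v : Fin k) (b w : Fin l) → ⌊ a ≟ v ⌋ ∧ ⌊ b ≟ w ⌋ ≡ true → a ≡ v × b ≡ w
≟∧≟≡true⇒≡ a v b w e  with a ≟ v | b ≟ w
≟∧≟≡true⇒≡ a v b w e  | yes a≡v | yes b≡w = a≡v , b≡w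
≟∧≟≡true⇒≡ a v b w () | yes _   | no _
≟∧≟≡true⇒≡ a v b w () | no _    | _

≟∧≟-refl : ∀ {k l} (v : Fin k) (w : Fin l) → ⌊ v ≟ v ⌋ ∧ ⌊ w ≟ w ⌋ ≡ true
≟∧≟-refl v w with v ≟ v | w ≟ w
... | yes _  | yes _  = refl
... | no v≢v | _      = ⊥-elim (v≢v refl)
... | yes _  | no w≢w = ⊥-elim (w≢w refl)

data Branch : Set where
  b₁ b₂ b₃ : Branch

_≟ᵇ_ : (i j : Branch) → Dec (i ≡ j)
b₁ ≟ᵇ b₁ = yes refl
b₁ ≟ᵇ b₂ = no λ ()
b₁ ≟ᵇ b₃ = no λ ()
b₂ ≟ᵇ b₁ = no λ ()
b₂ ≟ᵇ b₂ = yes refl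
b₂ ≟ᵇ b₃ = no λ ()
b₃ ≟ᵇ b₁ = no λ ()
b₃ ≟ᵇ b₂ = no λ ()
b₃ ≟ᵇ b₃ = yes refl

next : Branch → Branch
next b₁ = b₂
next b₂ = b₃
next b₃ = b₁

next≢ : ∀ i → next i ≢ i
next≢ b₁ ()
next≢ b₂ ()
next≢ b₃ ()

module Delta (G₁ G₂ G₃ : Graph) (v₁ : Fin (n G₁)) (v₂ : Fin (n G₂)) (v₃ : Fin (n G₃)) where

  D : Graph
  D = deltaComp G₁ G₂ G₃ v₁ v₂ v₃

  open Automorphisms D public

  branch : Branch → Graph
  branch b₁ = G₁
  branch b₂ = G₂
  branch b₃ = G₃

  root : ∀ i → Fin (n (branch i))
  root b₁ = v₁
  root b₂ = v₂
  root b₃ = v₃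

  BranchIso : Branch → Branch → Set
  BranchIso i j = RootedIso (branch i) (root i) (branch j) (root j)

  BranchIso-sym : ∀ i i′ → BranchIso i i′ → BranchIso i′ i
  BranchIso-sym i i′ = RootedIso-sym {branch i} {root i} {branch i′} {root i′}

  BranchIso-trans : ∀ i i′ i″ → BranchIso i i′ → BranchIso i′ i″ → BranchIso i i″
  BranchIso-trans i i′ i″ =
    RootedIso-trans {branch i} {root i} {branch i′} {root i′} {branch i″} {root i″}

  embed : ∀ i → Fin (n (branch i)) → Fin (n D)
  embed b₁ a = a ↑ˡ (n G₂ + n G₃)
  embed b₂ a = n G₁ ↑ʳ (a ↑ˡ n G₃)
  embed b₃ a = n G₁ ↑ʳ (n G₂ ↑ʳ a)

  corner : Branch → Fin (n D)
  corner i = embed i (root i)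

  private
    tag : ∀ i → Fin (n (branch i)) → Part (n G₁) (n G₂) (n G₃)
    tag b₁ a = inj₁ a
    tag b₂ a = inj₂ (inj₁ a)
    tag b₃ a = inj₂ (inj₂ a)

    part-embed : ∀ i a → part (n G₁) (n G₂) (n G₃) (embed i a) ≡ tag i a
    part-embed b₁ a rewrite splitAt-↑ˡ (n G₁) a (n G₂ + n G₃) = refl
    part-embed b₂ a rewrite splitAt-↑ʳ (n G₁) (n G₂ + n G₃) (a ↑ˡ n G₃)
                          | splitAt-↑ˡ (n G₂) a (n G₃) = refl
    part-embed b₃ a rewrite splitAt-↑ʳ (n G₁) (n G₂ + n G₃) (n G₂ ↑ʳ a)
                          | splitAt-↑ʳ (n G₂) (n G₃) a = refl

    untag : Part (n G₁) (n G₂) (n G₃) → Σ Branch λ i → Fin (n (branch i))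
    untag (inj₁ a)        = b₁ , a
    untag (inj₂ (inj₁ a)) = b₂ , a
    untag (inj₂ (inj₂ a)) = b₃ , a

    untag-tag : ∀ i a → untag (tag i a) ≡ (i , a)
    untag-tag b₁ a = refl
    untag-tag b₂ a = refl
    untag-tag b₃ a = refl

    embed-injective′ : ∀ {i j a b} → embed i a ≡ embed j b → (i , a) ≡ (j , b)
    embed-injective′ {i} {j} {a} {b} e = begin
      (i , a)                                        ≡⟨ untag-tag i a ⟨
      untag (tag i a)                                ≡⟨ cong untag (part-embed i a) ⟨
      untag (part (n G₁) (n G₂) (n G₃) (embed i a))  ≡⟨ cong (untag ∘ part _ _ _) e ⟩
      untag (part (n G₁) (n G₂) (n G₃) (embed j b))  ≡⟨ cong untag (part-embed j b) ⟩
      untag (tag j b)                                ≡⟨ untag-tag j b ⟩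
      (j , b)                                        ∎
      where open ≡-Reasoning

  embed-branch : ∀ {i j a b} → embed i a ≡ embed j b → i ≡ j
  embed-branch {i} {j} {a} {b} e = cong proj₁ (embed-injective′ {i} {j} {a} {b} e)

  embed-injective : ∀ {i a b} → embed i a ≡ embed i b → a ≡ b
  embed-injective {i} {a} {b} e with embed-injective′ {i} {i} {a} {b} e
  ... | refl = refl

  view : ∀ x → Σ Branch λ i → Σ (Fin (n (branch i))) λ a → x ≡ embed i a
  view x with splitAt (n G₁) x in x≡
  ... | inj₁ a = b₁ , a , sym (splitAt⁻¹-↑ˡ x≡)
  ... | inj₂ y with splitAt (n G₂) y in y≡
  ...   | inj₁ b = b₂ , b , sym (trans (cong (n G₁ ↑ʳ_) (splitAt⁻¹-↑ˡ y≡)) (splitAt⁻¹-↑ʳ x≡))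
  ...   | inj₂ c = b₃ , c , sym (trans (cong (n G₁ ↑ʳ_) (splitAt⁻¹-↑ʳ y≡)) (splitAt⁻¹-↑ʳ x≡))

  adj-embed : ∀ i a b → adj D (embed i a) (embed i b) ≡ adj (branch i) a b
  adj-embed b₁ a b rewrite part-embed b₁ a | part-embed b₁ b = refl
  adj-embed b₂ a b rewrite part-embed b₂ a | part-embed b₂ b = refl
  adj-embed b₃ a b rewrite part-embed b₃ a | part-embed b₃ b = refl

  adj-embed-cross : ∀ {i j} → i ≢ j → ∀ a b →
    adj D (embed i a) (embed j b) ≡ ⌊ a ≟ root i ⌋ ∧ ⌊ b ≟ root j ⌋
  adj-embed-cross {b₁} {b₁} i≢j = ⊥-elim (i≢j refl)
  adj-embed-cross {b₂} {b₂} i≢j = ⊥-elim (i≢j refl)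
  adj-embed-cross {b₃} {b₃} i≢j = ⊥-elim (i≢j refl)
  adj-embed-cross {b₁} {b₂} _ a b rewrite part-embed b₁ a | part-embed b₂ b = refl
  adj-embed-cross {b₁} {b₃} _ a b rewrite part-embed b₁ a | part-embed b₃ b = refl
  adj-embed-cross {b₂} {b₁} _ a b rewrite part-embed b₂ a | part-embed b₁ b = refl
  adj-embed-cross {b₂} {b₃} _ a b rewrite part-embed b₂ a | part-embed b₃ b = refl
  adj-embed-cross {b₃} {b₁} _ a b rewrite part-embed b₃ a | part-embed b₁ b = refl
  adj-embed-cross {b₃} {b₂} _ a b rewrite part-embed b₃ a | part-embed b₂ b = refl

  adj-corners : ∀ {i j} → i ≢ j → adj D (corner i) (corner j) ≡ true
  adj-corners {i} {j} i≢j = trans (adj-embed-cross i≢j _ _) (≟∧≟-refl (root i) (root j))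

  OnTriangle : Fin (n D) → Set
  OnTriangle x = Σ Branch λ i → x ≡ corner i

  onTriangle? : ∀ x → Dec (OnTriangle x)
  onTriangle? x with x ≟ corner b₁ | x ≟ corner b₂ | x ≟ corner b₃
  ... | yes e | _     | _     = yes (b₁ , e)
  ... | no _  | yes e | _     = yes (b₂ , e)
  ... | no _  | no _  | yes e = yes (b₃ , e)
  ... | no ¬1 | no ¬2 | no ¬3 = no λ { (b₁ , e) → ¬1 e ; (b₂ , e) → ¬2 e ; (b₃ , e) → ¬3 e }

  onTriangle-embed : ∀ {i a} → OnTriangle (embed i a) → a ≡ root i
  onTriangle-embed {i} {a} (j , e) with embed-branch {i} {j} {a} e
  ... | refl = embed-injective e

  cross-edge-on-triangle : ∀ {i j a b} → i ≢ j → adj D (embed i a) (embed j b) ≡ true →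
    OnTriangle (embed i a) × OnTriangle (embed j b)
  cross-edge-on-triangle {i} {j} {a} {b} i≢j e
    with ≟∧≟≡true⇒≡ a (root i) b (root j) (trans (sym (adj-embed-cross i≢j a b)) e)
  ... | refl , refl = (i , refl) , (j , refl)

  no-triangle-edge-in-branch : ∀ i a b → adj (branch i) a b ≡ true →
    ¬ (OnTriangle (embed i a) × OnTriangle (embed i b))
  no-triangle-edge-in-branch i a b e (ta , tb)
    with onTriangle-embed {i} ta | onTriangle-embed {i} tb
  ... | refl | refl with trans (sym (irrefl (branch i) (root i))) e
  ...   | ()

  embed-Reach : ∀ i {S : Fin (n D) → Set} →
    (∀ a b → adj (branch i) a b ≡ true → ¬ (S (embed i a) × S (embed i b))) →
    ∀ {a b} → Reach (branch i) (const ⊥) a b → Reach D S (embed i a) (embed i b)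
  embed-Reach i no-S-edge = Reach-map (embed i) (adj-embed i) (λ a b e _ → no-S-edge a b e)

  Reach-within-branch : ∀ {i a y} → Reach D OnTriangle (embed i a) y →
    Σ (Fin (n (branch i))) λ b → y ≡ embed i b
  Reach-within-branch here = _ , refl
  Reach-within-branch {i} (step {z = z} p e ¬T) with Reach-within-branch {i} p | view z
  ... | b , refl | j , c , refl with j ≟ᵇ i
  ...   | yes refl = c , refl
  ...   | no j≢i   = ⊥-elim (¬T (cross-edge-on-triangle (j≢i ∘ sym) e))

  embed-connected : ∀ i → Connected (branch i) → ∀ a b → Reach D (const ⊥) (embed i a) (embed i b)
  embed-connected i conn a b = embed-Reach i (λ _ _ _ → proj₁) (conn a b)

  deltaComp-connected : (∀ i → Connected (branch i)) → Connected D
  deltaComp-connected conn x y with view x | view y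
  ... | i , a , refl | j , b , refl with i ≟ᵇ j
  ...   | yes refl = embed-connected i (conn i) a b
  ...   | no i≢j   = Reach-trans (embed-connected i (conn i) a (root i))
                       (Reach-trans (step here (adj-corners i≢j) proj₁)
                                    (embed-connected j (conn j) (root j) b))

Δ-order : ℕ → ℕ
Δ-order zero    = 2
Δ-order (suc j) = Δ-order j + (Δ-order j + Δ-order j)

InΔ⇒order : ∀ {j H} → InΔ j H → n H ≡ Δ-order j
InΔ⇒order (base H≅K₂) = ↔⇒≡ (proj₁ H≅K₂)
InΔ⇒order (step _ _ _ _ _ _ d₁ d₂ d₃ H≅D) =
  trans (↔⇒≡ (proj₁ H≅D)) (cong₂ _+_ (InΔ⇒order d₁) (cong₂ _+_ (InΔ⇒order d₂) (InΔ⇒order d₃)))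

K₂-connected : Connected K₂
K₂-connected zero       zero       = here
K₂-connected zero       (suc zero) = step here refl proj₁
K₂-connected (suc zero) zero       = step here refl proj₁
K₂-connected (suc zero) (suc zero) = here

Connected-≅ : ∀ {G H} → G ≅ H → Connected H → Connected G
Connected-≅ {G} {H} (π , π-adj) conn x y =
  subst₂ (Reach G (const ⊥)) (inverseˡ π) (inverseˡ π)
    (Reach-map (π ⟨$⟩ˡ_) (Transport.adj⁻¹ {G} {H} (π , π-adj)) (λ _ _ _ _ → proj₁)
      (conn (π ⟨$⟩ʳ x) (π ⟨$⟩ʳ y)))

InΔ⇒connected : ∀ {j H} → InΔ j H → Connected H
InΔ⇒connected (base H≅K₂) = Connected-≅ H≅K₂ K₂-connected
InΔ⇒connected (step G₁ G₂ G₃ v₁ v₂ v₃ d₁ d₂ d₃ H≅D) =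
  Connected-≅ H≅D (Delta.deltaComp-connected G₁ G₂ G₃ v₁ v₂ v₃ λ
    { b₁ → InΔ⇒connected d₁ ; b₂ → InΔ⇒connected d₂ ; b₃ → InΔ⇒connected d₃ })

module Rigid {G₁ G₂ G₃ : Graph} (v₁ : Fin (n G₁)) (v₂ : Fin (n G₂)) (v₃ : Fin (n G₃))
             {j} (d₁ : InΔ j G₁) (d₂ : InΔ j G₂) (d₃ : InΔ j G₃) where

  open Delta G₁ G₂ G₃ v₁ v₂ v₃ public

  branch-InΔ : ∀ i → InΔ j (branch i)
  branch-InΔ b₁ = d₁
  branch-InΔ b₂ = d₂
  branch-InΔ b₃ = d₃

  branch-order : ∀ i i′ → n (branch i) ≡ n (branch i′)
  branch-order i i′ = trans (InΔ⇒order (branch-InΔ i)) (sym (InΔ⇒order (branch-InΔ i′)))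

  branch-connected : ∀ i → Connected (branch i)
  branch-connected i = InΔ⇒connected (branch-InΔ i)

  Reach-bound : ∀ i {m} (h : Fin m → Fin (n D)) → Injective _≡_ _≡_ h →
    (∀ k → Reach D OnTriangle (corner i) (h k)) → m ≤ n (branch i)
  Reach-bound i h h-injective walk = injective⇒≤ {f = proj₁ ∘ inside} λ {k} {l} e →
    h-injective (trans (proj₂ (inside k)) (trans (cong (embed i) e) (sym (proj₂ (inside l)))))
    where
    inside : ∀ k → Σ (Fin (n (branch i))) λ b → h k ≡ embed i b
    inside k = Reach-within-branch (walk k)

  corner-then-next : ∀ m → Fin (suc (n (branch (next m)))) → Fin (n D)
  corner-then-next m zero    = corner m
  corner-then-next m (suc z) = embed (next m) z

  corner-then-next-injective : ∀ m → Injective _≡_ _≡_ (corner-then-next m)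
  corner-then-next-injective m {zero}  {zero}  _ = refl
  corner-then-next-injective m {zero}  {suc _} e = ⊥-elim (next≢ m (sym (embed-branch e)))
  corner-then-next-injective m {suc _} {zero}  e = ⊥-elim (next≢ m (embed-branch e))
  corner-then-next-injective m {suc _} {suc _} e = cong suc (embed-injective e)

  reach-corner-and-next : (S : Fin (n D) → Set) → (∀ x → Dec (S x)) → ∀ {m c} → S (embed m c) →
    (∀ z → ¬ S (embed (next m) z)) →
    Σ (Fin (n D)) λ w → S w × ∀ k → Reach D S w (corner-then-next m k)
  reach-corner-and-next S S? {m} {c} hit next-avoids-S
    with first-hit S? (embed-connected m (branch-connected m) (root m) c) hit
  ... | w , Sw , corner⇝w = w , Sw , walk
    where
    walk : ∀ k → Reach D S w (corner-then-next m k)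
    walk zero    = Reach-sym corner⇝w
    walk (suc z) = Reach-trans (Reach-sym corner⇝w)
      (Reach-trans (step here (adj-corners (next≢ m ∘ sym)) (next-avoids-S _ ∘ proj₂))
        (embed-Reach (next m) (λ _ b _ → next-avoids-S b ∘ proj₂)
          (branch-connected (next m) (root (next m)) z)))

  module MovedCorner (f : Aut D) {i m c} (moved : f · corner i ≡ embed m c)
                     (off : ¬ OnTriangle (embed m c)) where

    image-in-branch : ∀ l → Σ (Fin (n (branch m))) λ c′ → f · corner l ≡ embed m c′
    image-in-branch l with l ≟ᵇ i | view (f · corner l)
    ... | yes refl | _ = c , moved
    ... | no l≢i | m′ , c′ , moved′ with m′ ≟ᵇ m
    ...   | yes refl = c′ , moved′
    ...   | no m′≢m  = ⊥-elim (off (proj₁ (cross-edge-on-triangle (m′≢m ∘ sym) image-edge)))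
      where
      image-edge : adj D (embed m c) (embed m′ c′) ≡ true
      image-edge = subst₂ (λ x y → adj D x y ≡ true) moved moved′
                     (trans (proj₂ f _ _) (adj-corners (l≢i ∘ sym)))

    private
      g = inverse f

      Image : Fin (n D) → Set
      Image x = OnTriangle (g · x)

      hit : Image (embed m c)
      hit = i , trans (cong (g ·_) (sym moved)) (·-inverseˡ f)

      next-avoids-Image : ∀ z → ¬ Image (embed (next m) z)
      next-avoids-Image z (l , gz≡) with image-in-branch l
      ... | c′ , fl≡ =
        next≢ m (embed-branch (trans (sym (·-inverseʳ f)) (trans (cong (f ·_) gz≡) fl≡)))

    absurd : ⊥
    absurd with reach-corner-and-next Image (onTriangle? ∘ (g ·_)) hit next-avoids-Image
    ... | w , (j₀ , gw≡) , walk =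
      <-irrefl (branch-order (next m) j₀)
        (Reach-bound j₀ ((g ·_) ∘ corner-then-next m)
          (corner-then-next-injective m ∘ ·-injective g) pulled)
      where
      pulled : ∀ k → Reach D OnTriangle (corner j₀) (g · corner-then-next m k)
      pulled k = subst (λ x → Reach D OnTriangle x _) gw≡
                   (Reach-map (g ·_) (proj₂ g) (λ _ _ _ → id) (walk k))

  aut-preserves-triangle : (f : Aut D) → ∀ i → OnTriangle (f · corner i)
  aut-preserves-triangle f i with onTriangle? (f · corner i)
  ... | yes on = on
  ... | no off with view (f · corner i)
  ...   | m , c , moved =
    ⊥-elim (MovedCorner.absurd f {i} {m} {c} moved (off ∘ subst OnTriangle (sym moved)))

  Reach-aut : (f : Aut D) → ∀ {x y} → Reach D OnTriangle x y → Reach D OnTriangle (f · x) (f · y)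
  Reach-aut f = Reach-map (f ·_) (proj₂ f) λ a b _ ¬T (Ta , Tb) → ¬T (back a Ta , back b Tb)
    where
    back : ∀ x → OnTriangle (f · x) → OnTriangle x
    back x (l , fx≡) = subst OnTriangle (·-inverseˡ f)
      (subst (OnTriangle ∘ (inverse f ·_)) (sym fx≡) (aut-preserves-triangle (inverse f) l))

  aut-maps-branch : (f : Aut D) → ∀ i i′ {a a′} → f · embed i a ≡ embed i′ a′ →
    ∀ b → Σ (Fin (n (branch i′))) λ b′ → f · embed i b ≡ embed i′ b′
  aut-maps-branch f i i′ {a} maps b =
    Reach-within-branch (subst (λ x → Reach D OnTriangle x (f · embed i b)) maps
      (Reach-aut f (embed-Reach i (no-triangle-edge-in-branch i) (branch-connected i a b))))

  aut-maps-corner : (f : Aut D) → ∀ i i′ {a a′} → f · embed i a ≡ embed i′ a′ →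
    f · corner i ≡ corner i′
  aut-maps-corner f i i′ maps with aut-maps-branch f i i′ maps (root i)
  ... | b′ , froot≡ = trans froot≡
    (cong (embed i′) (onTriangle-embed (subst OnTriangle froot≡ (aut-preserves-triangle f i))))

  restriction : (f : Aut D) → ∀ i i′ {a a′} → f · embed i a ≡ embed i′ a′ →
    Σ (BranchIso i i′) λ ρ → ∀ b → embed i′ (proj₁ ρ ⟨$⟩ʳ b) ≡ f · embed i b
  restriction f i i′ {a} {a′} maps =
    (permutation to from to-from from-to , to-adj , to-root) , to-spec
    where
    open ≡-Reasoning
    g = inverse f
    maps⁻¹ : g · embed i′ a′ ≡ embed i a
    maps⁻¹ = trans (cong (g ·_) (sym maps)) (·-inverseˡ f)
    to : Fin (n (branch i)) → Fin (n (branch i′))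
    to b = proj₁ (aut-maps-branch f i i′ maps b)
    to-spec : ∀ b → embed i′ (to b) ≡ f · embed i b
    to-spec b = sym (proj₂ (aut-maps-branch f i i′ maps b))
    from : Fin (n (branch i′)) → Fin (n (branch i))
    from b′ = proj₁ (aut-maps-branch g i′ i maps⁻¹ b′)
    from-spec : ∀ b′ → embed i (from b′) ≡ g · embed i′ b′
    from-spec b′ = sym (proj₂ (aut-maps-branch g i′ i maps⁻¹ b′))
    to-from : ∀ b′ → to (from b′) ≡ b′
    to-from b′ = embed-injective (begin
      embed i′ (to (from b′))  ≡⟨ to-spec (from b′) ⟩
      f · embed i (from b′)    ≡⟨ cong (f ·_) (from-spec b′) ⟩
      f · g · embed i′ b′      ≡⟨ ·-inverseʳ f ⟩
      embed i′ b′              ∎)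
    from-to : ∀ b → from (to b) ≡ b
    from-to b = embed-injective (begin
      embed i (from (to b))    ≡⟨ from-spec (to b) ⟩
      g · embed i′ (to b)      ≡⟨ cong (g ·_) (to-spec b) ⟩
      g · f · embed i b        ≡⟨ ·-inverseˡ f ⟩
      embed i b                ∎)
    to-adj : ∀ b c → adj (branch i′) (to b) (to c) ≡ adj (branch i) b c
    to-adj b c = begin
      adj (branch i′) (to b) (to c)               ≡⟨ adj-embed i′ (to b) (to c) ⟨
      adj D (embed i′ (to b)) (embed i′ (to c))   ≡⟨ cong₂ (adj D) (to-spec b) (to-spec c) ⟩
      adj D (f · embed i b) (f · embed i c)       ≡⟨ proj₂ f (embed i b) (embed i c) ⟩
      adj D (embed i b) (embed i c)               ≡⟨ adj-embed i b c ⟩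
      adj (branch i) b c                          ∎
    to-root : to (root i) ≡ root i′
    to-root = embed-injective (trans (to-spec (root i)) (aut-maps-corner f i i′ maps))

  embed-separated-root : ∀ P i {m} (R : AtLeastOrbitsFixing m (branch i) (root i)) →
    Separated P (embed i ∘ proj₁ R)
  embed-separated-root P i (r , separated) p q f _ maps with restriction f i i maps
  ... | (π , π-adj , π-root) , spec =
    separated p q (π , π-adj) π-root (embed-injective (trans (spec (r p)) maps))

  embed-separated-fixing : ∀ i c {m} (R : AtLeastOrbitsFixing m (branch i) c) →
    Separated (Fixes (embed i c)) (embed i ∘ proj₁ R)
  embed-separated-fixing i c (r , separated) p q f fc maps with restriction f i i maps
  ... | (π , π-adj , _) , spec =
    separated p q (π , π-adj) (embed-injective (trans (spec c) fc))
      (embed-injective (trans (spec (r p)) maps))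

  embed-apart : ∀ P {i i′} → ¬ BranchIso i i′ → ∀ {m m′} (r : Fin m → Fin (n (branch i)))
    (r′ : Fin m′ → Fin (n (branch i′))) → Apart P (embed i ∘ r) (embed i′ ∘ r′)
  embed-apart P {i} {i′} ¬i≅i′ r r′ p q f _ maps = ¬i≅i′ (proj₁ (restriction f i i′ maps))

  embed-apart-fixing : ∀ {i i′} c → i ≢ i′ → ∀ {m m′} (r : Fin m → Fin (n (branch i)))
    (r′ : Fin m′ → Fin (n (branch i′))) → Apart (Fixes (embed i c)) (embed i ∘ r) (embed i′ ∘ r′)
  embed-apart-fixing {i} {i′} c i≢i′ r r′ p q f fc maps with aut-maps-branch f i i′ maps c
  ... | _ , fc≡ = i≢i′ (embed-branch (trans (sym fc) fc≡))

InΔ⇒orbits-fixing : ∀ {j H} → InΔ j H → ∀ v → AtLeastOrbitsFixing (2 ^ suc j) H v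
InΔ⇒orbits-fixing {H = H} (base H≅K₂) v = two-orbits-fixing H (proj₂ (other-vertex-≅K₂ {H} H≅K₂ v))
InΔ⇒orbits-fixing {H = H} (step G₁ G₂ G₃ v₁ v₂ v₃ d₁ d₂ d₃ H≅D) v =
  AtLeastOrbitsFixing-≅ {H} {D} H≅D (orbits-fixing (proj₁ H≅D ⟨$⟩ʳ v))
  where
  open Rigid v₁ v₂ v₃ d₁ d₂ d₃
  orbits-fixing : ∀ x → AtLeastOrbitsFixing _ D x
  orbits-fixing x with view x
  ... | i , c , refl =
    _ , Separated-pair (embed-separated-fixing i c here-reps)
          (embed-separated-root _ (next i) next-reps)
          (embed-apart-fixing c i≢next _ _)
          (Apart-sym Fixes-inverse (embed-apart-fixing c i≢next _ _))
    where
    i≢next = next≢ i ∘ sym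
    here-reps = InΔ⇒orbits-fixing (branch-InΔ i) c
    next-reps = InΔ⇒orbits-fixing (branch-InΔ (next i)) (root (next i))

module Composition {G₁ G₂ G₃ : Graph} (v₁ : Fin (n G₁)) (v₂ : Fin (n G₂)) (v₃ : Fin (n G₃))
                   {k} (d₁ : InΔ k G₁) (d₂ : InΔ k G₂) (d₃ : InΔ k G₃) where

  open Rigid v₁ v₂ v₃ d₁ d₂ d₃ public

  branch-reps : Branch → Fin (2 ^ suc k) → Fin (n D)
  branch-reps i = embed i ∘ proj₁ (InΔ⇒orbits-fixing (branch-InΔ i) (root i))

  branch-reps-separated : ∀ i → Separated (const ⊤) (branch-reps i)
  branch-reps-separated i =
    embed-separated-root (const ⊤) i (InΔ⇒orbits-fixing (branch-InΔ i) (root i))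

  branch-reps-apart : ∀ {i i′} → ¬ BranchIso i i′ → Apart (const ⊤) (branch-reps i) (branch-reps i′)
  branch-reps-apart ¬i≅i′ = embed-apart (const ⊤) ¬i≅i′ _ _

  pair-separated : ∀ {i i′} → ¬ BranchIso i i′ →
    Separated (const ⊤) (branch-reps i ++ (branch-reps i′ ++ []))
  pair-separated {i} {i′} ¬i≅i′ =
    Separated-pair (branch-reps-separated i) (branch-reps-separated i′)
      (branch-reps-apart ¬i≅i′) (branch-reps-apart (¬i≅i′ ∘ BranchIso-sym i′ i))

  triple-separated : ¬ BranchIso b₁ b₂ → ¬ BranchIso b₁ b₃ → ¬ BranchIso b₂ b₃ →
    Separated (const ⊤) (branch-reps b₁ ++ (branch-reps b₂ ++ (branch-reps b₃ ++ [])))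
  triple-separated ¬r₁₂ ¬r₁₃ ¬r₂₃ =
    Separated-triple
      (branch-reps-separated b₁) (branch-reps-separated b₂) (branch-reps-separated b₃)
      (branch-reps-apart ¬r₁₂) (branch-reps-apart (¬r₁₂ ∘ BranchIso-sym b₂ b₁))
      (branch-reps-apart ¬r₁₃) (branch-reps-apart (¬r₁₃ ∘ BranchIso-sym b₃ b₁))
      (branch-reps-apart ¬r₂₃) (branch-reps-apart (¬r₂₃ ∘ BranchIso-sym b₃ b₂))

  TypeA-from-R₁₂-R₁₃ : BranchIso b₁ b₂ → BranchIso b₁ b₃ → TypeA G₁ G₂ G₃ v₁ v₂ v₃
  TypeA-from-R₁₂-R₁₃ r₁₂ r₁₃ = r₁₂ , r₁₃ , BranchIso-trans b₂ b₁ b₃ (BranchIso-sym b₁ b₂ r₁₂) r₁₃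

  TypeA-from-R₁₂-R₂₃ : BranchIso b₁ b₂ → BranchIso b₂ b₃ → TypeA G₁ G₂ G₃ v₁ v₂ v₃
  TypeA-from-R₁₂-R₂₃ r₁₂ r₂₃ = r₁₂ , BranchIso-trans b₁ b₂ b₃ r₁₂ r₂₃ , r₂₃

  TypeA-from-R₁₃-R₂₃ : BranchIso b₁ b₃ → BranchIso b₂ b₃ → TypeA G₁ G₂ G₃ v₁ v₂ v₃
  TypeA-from-R₁₃-R₂₃ r₁₃ r₂₃ = BranchIso-trans b₁ b₃ b₂ r₁₃ (BranchIso-sym b₂ b₃ r₂₃) , r₁₃ , r₂₃

  TypeB⇒nonIso : TypeB G₁ G₂ G₃ v₁ v₂ v₃ → Σ Branch λ i → Σ Branch λ i′ → ¬ BranchIso i i′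
  TypeB⇒nonIso (inj₁ (_ , ¬r₁₃ , _))    = b₁ , b₃ , ¬r₁₃
  TypeB⇒nonIso (inj₂ (inj₁ (¬r₁₂ , _))) = b₁ , b₂ , ¬r₁₂
  TypeB⇒nonIso (inj₂ (inj₂ (¬r₁₂ , _))) = b₁ , b₂ , ¬r₁₂

  TypeC⇒nonIso : TypeC G₁ G₂ G₃ v₁ v₂ v₃ →
    ¬ BranchIso b₁ b₂ × ¬ BranchIso b₁ b₃ × ¬ BranchIso b₂ b₃
  TypeC⇒nonIso (¬A , ¬B) = ¬r₁₂ , ¬r₁₃ , ¬r₂₃
    where
    ¬r₁₂ : ¬ BranchIso b₁ b₂
    ¬r₁₂ r₁₂ = ¬B (inj₁ (r₁₂ , ¬A ∘ TypeA-from-R₁₂-R₁₃ r₁₂ , ¬A ∘ TypeA-from-R₁₂-R₂₃ r₁₂))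
    ¬r₁₃ : ¬ BranchIso b₁ b₃
    ¬r₁₃ r₁₃ = ¬B (inj₂ (inj₁ ( (λ r₁₂ → ¬A (TypeA-from-R₁₂-R₁₃ r₁₂ r₁₃))
                              , r₁₃ , ¬A ∘ TypeA-from-R₁₃-R₂₃ r₁₃)))
    ¬r₂₃ : ¬ BranchIso b₂ b₃
    ¬r₂₃ r₂₃ = ¬B (inj₂ (inj₂ ( (λ r₁₂ → ¬A (TypeA-from-R₁₂-R₂₃ r₁₂ r₂₃))
                              , (λ r₁₃ → ¬A (TypeA-from-R₁₃-R₂₃ r₁₃ r₂₃)) , r₂₃)))

lemma5p5 : (k : ℕ) → 1 ≤ k → (G : Graph) → InΔ k G →
    (G₁ G₂ G₃ : Graph) (v₁ : Fin (n G₁)) (v₂ : Fin (n G₂)) (v₃ : Fin (n G₃)) →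
    InΔ (k ∸ 1) G₁ → InΔ (k ∸ 1) G₂ → InΔ (k ∸ 1) G₃ →
    G ≅ deltaComp G₁ G₂ G₃ v₁ v₂ v₃ →
    (TypeA G₁ G₂ G₃ v₁ v₂ v₃ → AtLeastOrbits (2 ^ k) G)
    × (TypeB G₁ G₂ G₃ v₁ v₂ v₃ → AtLeastOrbits (2 * 2 ^ k) G)
    × (TypeC G₁ G₂ G₃ v₁ v₂ v₃ → AtLeastOrbits (3 * 2 ^ k) G)
lemma5p5 (suc k) _ G _ G₁ G₂ G₃ v₁ v₂ v₃ d₁ d₂ d₃ G≅D =
    (λ _ → orbits (branch-reps-separated b₁))
  , (λ typeB → let (_ , _ , ¬i≅i′) = TypeB⇒nonIso typeB in orbits (pair-separated ¬i≅i′))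
  , (λ typeC → let (¬r₁₂ , ¬r₁₃ , ¬r₂₃) = TypeC⇒nonIso typeC
               in orbits (triple-separated ¬r₁₂ ¬r₁₃ ¬r₂₃))
  where
  open Composition v₁ v₂ v₃ d₁ d₂ d₃
  orbits : ∀ {m} {r : Fin m → Fin (n D)} → Separated (const ⊤) r → AtLeastOrbits m G
  orbits = AtLeastOrbits-≅ {G} {D} G≅D
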